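{- Let $k\geq 2$ and $1\leq i\leq k$. If $G$ is a connected graph of order $n\geq i+2$ that is not a path graph, then $\gamma^r_k(G)=n-i$ if and only if $\dim(G)=n-i$.
   Context: For a graph $G=(V,E)$ and $k\geq 1$, a set $D\subseteq V$ is distance $k$-dominating if every $v\in V\setminus D$ is at distance at most $k$ from some vertex of $D$. An ordered set $W=\{w_1,\dots,w_r\}$ is a resolving set if for all distinct $u,v\in V\setminus W$ the distance vectors $(d_G(u,w_i))_i$ and $(d_G(v,w_i))_i$ differ; $\dim(G)$ is the minimum size of a resolving set. $\gamma^r_k(G)$ is the minimum cardinality of a set that is both resolving and distance $k$-dominating. -}

module Defs where

open import Data.Nat using (ℕ; zero; suc; _≤_)
open import Data.Fin using (Fin; toℕ)
open import Data.Fin.Subset using (Subset; _∈_; _∉_; ∣_∣)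
open import Data.Product using (Σ; ∃; _×_; _,_)
open import Data.Sum using (_⊎_)
open import Relation.Nullary using (¬_)
open import Relation.Binary.PropositionalEquality using (_≡_; _≢_)
open import Function.Bundles using (_↔_; Inverse)

record Graph (n : ℕ) : Set₁ where
  field
    Adj       : Fin n → Fin n → Set
    Adj-sym   : ∀ {u v} → Adj u v → Adj v u
    Adj-irrefl : ∀ {u} → ¬ Adj u u

module _ {n : ℕ} (G : Graph n) where
  open Graph G

  data Walk : Fin n → Fin n → ℕ → Set where
    nil  : ∀ {u} → Walk u u 0
    cons : ∀ {u w v m} → Adj u w → Walk w v m → Walk u v (suc m)

  Connected : Set
  Connected = ∀ u v → ∃ λ m → Walk u v m

  Dist : Fin n → Fin n → ℕ → Set
  Dist u v m = Walk u v m × (∀ m′ → Walk u v m′ → m ≤ m′)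

  -- G is isomorphic to the path graph P_n
  IsPath : Set
  IsPath = Σ (Fin n ↔ Fin n) λ σ →
    ∀ a b → (Adj (Inverse.to σ a) (Inverse.to σ b) →
               (toℕ b ≡ suc (toℕ a)) ⊎ (toℕ a ≡ suc (toℕ b)))
          × ((toℕ b ≡ suc (toℕ a)) ⊎ (toℕ a ≡ suc (toℕ b)) →
               Adj (Inverse.to σ a) (Inverse.to σ b))

  DistDominating : ℕ → Subset n → Set
  DistDominating k D =
    ∀ v → v ∉ D → ∃ λ u → u ∈ D × ∃ λ m → Dist v u m × m ≤ k

  Resolving : Subset n → Set
  Resolving W =
    ∀ u v → u ∉ W → v ∉ W → u ≢ v →
      ∃ λ w → w ∈ W × ∃ λ a → ∃ λ b → Dist u w a × Dist v w b × a ≢ b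

IsMinCard : {n : ℕ} → (Subset n → Set) → ℕ → Set
IsMinCard {n} P m = (∃ λ S → P S × ∣ S ∣ ≡ m) × (∀ S → P S → m ≤ ∣ S ∣)

MetricDim : {n : ℕ} → Graph n → ℕ → Set
MetricDim G m = IsMinCard (Resolving G) m

ResolvingDomNum : {n : ℕ} → Graph n → ℕ → ℕ → Set
ResolvingDomNum G k m = IsMinCard (λ S → Resolving G S × DistDominating G k S) m

-- If W is resolving and v ∉ W, a geodesic from v to W passes only through
-- vertices outside W before its first hit, so every vertex lies within
-- n − |W| of W. Hence a resolving set of size n − i ≥ n − k is already
-- k-dominating, which gives dim = n − i ⇒ γ^r_k = n − i.
-- Conversely, let γ^r_k = n − i and let W be resolving. If n − |W| ≤ k then
-- W is k-dominating, so |W| ≥ n − i. Otherwise some vertex is at distance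
-- exactly k + 1 from W, along a geodesic q₀, …, q_{k+1} with q_{k+1} ∈ W.
-- If some z ∉ W is off this geodesic, V ∖ {z, q₁, …, q_k} contains W and is
-- resolving and k-dominating. Otherwise q₁ is the only neighbour of q₀ and
-- q₀, q₂ are the only ones of q₁, so (W ∖ {q_{k+1}}) ∪ {q₁} is resolving
-- (any other vertex of W separates q₀ from q₂) and k-dominating, unless
-- W = {q_{k+1}} and G is a path. Either way there is a resolving
-- k-dominating set T with n − |T| > k ≥ i, contradicting γ^r_k = n − i.
-- Distances to a set are found by search, which needs decidable adjacency;
-- as the goal there is a contradiction, decidability may be assumed.

module Submission where

open import Defs
open import Data.Empty using (⊥-elim)
open import Data.Fin using (Fin; toℕ; fromℕ<) renaming (zero to fzero; suc to fsuc)
open import Data.Fin.Properties using (any?; injective⇒≤; toℕ-fromℕ<; toℕ<n; toℕ-injective) renaming (_≟_ to _≟ᶠ_)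
open import Data.Fin.Subset using (Subset; _∈_; _∉_; _⊆_; ∣_∣; _∪_; ⁅_⁆; Nonempty; inside)
open import Data.Fin.Subset.Properties using (_∈?_; nonempty?; ∣p∣≤n; p⊂q⇒∣p∣<∣q∣; p⊆p∪q; x∈p∪q⁺; x∈p∪q⁻; x∈⁅x⁆; x∈⁅y⁆⇒x≡y)
open import Data.Nat using (ℕ; zero; suc; _+_; _∸_; _≤_; _<_; z≤n; s≤s; s≤s⁻¹)
open import Data.Nat.Properties renaming (_≟_ to _≟ⁿ_)
open import Data.Product using (Σ; ∃; _×_; _,_; proj₁; proj₂)
open import Data.Sum using (_⊎_; inj₁; inj₂)
open import Data.Vec using (tabulate)
open import Data.Vec.Properties using ([]=⇒lookup; lookup⇒[]=; lookup∘tabulate)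
open import Function using (_∘_)
open import Function.Bundles using (mk↔ₛ′)
open import Relation.Nullary using (¬_; Dec; yes; no; does)
open import Relation.Nullary.Decidable using (¬¬-excluded-middle; _×-dec_; _⊎-dec_; ¬?; decidable-stable)
open import Relation.Binary.Definitions using (tri<; tri≈; tri>)
open import Relation.Binary.PropositionalEquality using (_≡_; _≢_; refl; sym; trans; cong; subst)

minimal-witness : {P : ℕ → Set} → (∀ m → Dec (P m)) → ∀ m → P m →
                  Σ ℕ λ l → P l × (∀ m → P m → l ≤ m)
minimal-witness P? zero p = zero , p , λ _ _ → z≤n
minimal-witness P? (suc m) p with P? zero
... | yes p₀ = zero , p₀ , λ _ _ → z≤n
... | no ¬p₀ with minimal-witness (P? ∘ suc) m p
...   | l , pl , least = suc l , pl , λ { zero p₀ → ⊥-elim (¬p₀ p₀) ; (suc m′) p → s≤s (least m′ p) }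

¬¬-∀-Fin : ∀ {n} {P : Fin n → Set} → (∀ x → ¬ ¬ P x) → ¬ ¬ (∀ x → P x)
¬¬-∀-Fin {zero} _ k = k λ ()
¬¬-∀-Fin {suc n} h k =
  h fzero λ p₀ → ¬¬-∀-Fin (h ∘ fsuc) λ ps → k λ { fzero → p₀ ; (fsuc x) → ps x }

InjectiveBelow : ∀ {A : Set} → (ℕ → A) → ℕ → Set
InjectiveBelow g t = ∀ {s s′} → s < t → s′ < t → g s ≡ g s′ → s ≡ s′

injective-outside⇒≤∸∣∣ : ∀ {n} (S : Subset n) (g : ℕ → Fin n) t →
  (∀ s → s < t → g s ∉ S) → InjectiveBelow g t → t ≤ n ∸ ∣ S ∣
injective-outside⇒≤∸∣∣ S g t outside injective =
  m+n≤o⇒m≤o∸n t (counted S g t outside injective)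
  where
  counted : ∀ {n} (S : Subset n) (g : ℕ → Fin n) t →
    (∀ s → s < t → g s ∉ S) → InjectiveBelow g t → t + ∣ S ∣ ≤ n
  counted S g zero _ _ = ∣p∣≤n S
  counted S g (suc t) outside injective = begin
    suc t + ∣ S ∣    ≡⟨ sym (+-suc t ∣ S ∣) ⟩
    t + suc ∣ S ∣    ≤⟨ +-monoʳ-≤ t (p⊂q⇒∣p∣<∣q∣ (p⊆p∪q ⁅ g t ⁆ , g t , x∈p∪q⁺ (inj₂ (x∈⁅x⁆ (g t))) , outside t ≤-refl)) ⟩
    t + ∣ S ∪ ⁅ g t ⁆ ∣ ≤⟨ counted (S ∪ ⁅ g t ⁆) g t outside′ (λ s< s′< → injective (m≤n⇒m≤1+n s<) (m≤n⇒m≤1+n s′<)) ⟩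
    _ ∎
    where
    open ≤-Reasoning
    outside′ : ∀ s → s < t → g s ∉ S ∪ ⁅ g t ⁆
    outside′ s s<t s∈ with x∈p∪q⁻ S ⁅ g t ⁆ s∈
    ... | inj₁ s∈S = outside s (m≤n⇒m≤1+n s<t) s∈S
    ... | inj₂ s∈⁅t⁆ = <-irrefl (injective (m≤n⇒m≤1+n s<t) ≤-refl (x∈⁅y⁆⇒x≡y (g t) s∈⁅t⁆)) s<t

Consecutive : ℕ → ℕ → Set
Consecutive a b = b ≡ suc a ⊎ a ≡ suc b

consecutive : ∀ {a b} → a ≢ b → b ≤ suc a → a ≤ suc b → Consecutive a b
consecutive {a} {b} a≢b b≤1+a a≤1+b with <-cmp a b
... | tri< a<b _ _ = inj₁ (≤-antisym b≤1+a a<b)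
... | tri≈ _ a≡b _ = ⊥-elim (a≢b a≡b)
... | tri> _ _ b<a = inj₂ (≤-antisym a≤1+b b<a)

module _ {n : ℕ} {P : Fin n → Set} (P? : ∀ x → Dec (P x)) where

  fromDec : Subset n
  fromDec = tabulate (does ∘ P?)

  ∈-fromDec⁻ : ∀ {x} → x ∈ fromDec → P x
  ∈-fromDec⁻ {x} x∈ with P? x | trans (sym (lookup∘tabulate (does ∘ P?) x)) ([]=⇒lookup x∈)
  ... | yes p | _ = p
  ... | no _ | ()

  ∈-fromDec⁺ : ∀ {x} → P x → x ∈ fromDec
  ∈-fromDec⁺ {x} px = lookup⇒[]= x _ (trans (lookup∘tabulate (does ∘ P?) x) decided)
    where
    decided : does (P? x) ≡ inside
    decided with P? x
    ... | yes _ = refl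
    ... | no ¬px = ⊥-elim (¬px px)

  ∉-fromDec : ∀ {x} → x ∉ fromDec → ¬ P x
  ∉-fromDec x∉ px = x∉ (∈-fromDec⁺ px)

module WalkProperties {n : ℕ} (G : Graph n) where
  open Graph G

  _++ʷ_ : ∀ {u w v a b} → Walk G u w a → Walk G w v b → Walk G u v (a + b)
  nil ++ʷ q = q
  cons e p ++ʷ q = cons e (p ++ʷ q)

  reverseʷ : ∀ {u v m} → Walk G u v m → Walk G v u m
  reverseʷ nil = nil
  reverseʷ {m = suc m} (cons e p) =
    subst (Walk G _ _) (+-comm m 1) (reverseʷ p ++ʷ cons (Adj-sym e) nil)

  Dist-unique : ∀ {u v a b} → Dist G u v a → Dist G u v b → a ≡ b
  Dist-unique (p , a-least) (q , b-least) = ≤-antisym (a-least _ q) (b-least _ p)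

  Dist-sym : ∀ {u v m} → Dist G u v m → Dist G v u m
  Dist-sym (p , least) = reverseʷ p , λ m′ q → least m′ (reverseʷ q)

  Adj⇒Dist-1 : ∀ {u v} → Adj u v → Dist G u v 1
  Adj⇒Dist-1 {u} e = cons e nil , nonzero
    where
    nonzero : ∀ m → Walk G u _ m → 1 ≤ m
    nonzero zero nil = ⊥-elim (Adj-irrefl e)
    nonzero (suc m) _ = s≤s z≤n

  WalkSeq : (ℕ → Fin n) → ℕ → Set
  WalkSeq f m = ∀ t → t < m → Adj (f t) (f (suc t))

  Geodesic : (ℕ → Fin n) → ℕ → Set
  Geodesic f m = WalkSeq f m × Dist G (f 0) (f m) m

  walk⇒WalkSeq : ∀ {u v m} → Walk G u v m →
    Σ (ℕ → Fin n) λ f → f 0 ≡ u × f m ≡ v × WalkSeq f m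
  walk⇒WalkSeq {u} nil = (λ _ → u) , refl , refl , λ _ ()
  walk⇒WalkSeq {u} (cons e p) with walk⇒WalkSeq p
  ... | f , refl , f-end , steps = f′ , refl , f-end , steps′
    where
    f′ : ℕ → Fin n
    f′ zero = u
    f′ (suc t) = f t
    steps′ : WalkSeq f′ _
    steps′ zero _ = e
    steps′ (suc t) (s≤s t<m) = steps t t<m

  segment : ∀ {f m} → WalkSeq f m → ∀ s r → s + r ≤ m → Walk G (f s) (f (s + r)) r
  segment steps s zero _ rewrite +-identityʳ s = nil
  segment steps s (suc r) s+r<m rewrite +-suc s r =
    cons (steps s (≤-trans (s≤s (m≤m+n s r)) s+r<m)) (segment steps (suc s) r s+r<m)

  geodesic-segment : ∀ {f m} → Geodesic f m → ∀ s r → s + r ≤ m → Dist G (f s) (f (s + r)) r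
  geodesic-segment {f} {m} (steps , _ , least) s r s+r≤m = segment steps s r s+r≤m , shortest
    where
    e = m ∸ (s + r)
    s+r+e≡m : s + r + e ≡ m
    s+r+e≡m = m+[n∸m]≡n s+r≤m
    tail : Walk G (f (s + r)) (f m) e
    tail = subst (λ j → Walk G (f (s + r)) (f j) e) s+r+e≡m (segment steps (s + r) e (≤-reflexive s+r+e≡m))
    shortest : ∀ r′ → Walk G (f s) (f (s + r)) r′ → r ≤ r′
    shortest r′ p = +-cancelʳ-≤ e r r′ (+-cancelˡ-≤ s (r + e) (r′ + e) (begin
      s + (r + e)  ≡⟨ sym (+-assoc s r e) ⟩
      s + r + e    ≡⟨ s+r+e≡m ⟩
      m            ≤⟨ least _ (segment steps 0 s (m+n≤o⇒m≤o s s+r≤m) ++ʷ (p ++ʷ tail)) ⟩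
      s + (r′ + e) ∎))
      where open ≤-Reasoning

  geodesic-prefix : ∀ {f m} → Geodesic f m → ∀ t → t ≤ m → Dist G (f 0) (f t) t
  geodesic-prefix geo = geodesic-segment geo 0

  geodesic-injective : ∀ {f m} → Geodesic f m → ∀ {a b} → a ≤ m → b ≤ m → f a ≡ f b → a ≡ b
  geodesic-injective {f} geo {a} {b} a≤m b≤m fa≡fb =
    Dist-unique (geodesic-prefix geo a a≤m)
                (subst (λ x → Dist G (f 0) x b) (sym fa≡fb) (geodesic-prefix geo b b≤m))

  Dist⇒Geodesic : ∀ {u v m} → Dist G u v m →
    Σ (ℕ → Fin n) λ f → f 0 ≡ u × f m ≡ v × Geodesic f m
  Dist⇒Geodesic (p , least) with walk⇒WalkSeq p
  ... | f , refl , refl , steps = f , refl , refl , steps , p , least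

  Within : ℕ → Subset n → Fin n → Set
  Within k S v = ∃ λ u → u ∈ S × ∃ λ m → Dist G v u m × m ≤ k

  DistDominating-mono : ∀ {k k′ S} → k ≤ k′ → DistDominating G k S → DistDominating G k′ S
  DistDominating-mono k≤k′ dom v v∉S with dom v v∉S
  ... | u , u∈S , m , d , m≤k = u , u∈S , m , d , ≤-trans m≤k k≤k′

  Dist-to-member⇒Within : ∀ {S v w a} → w ∈ S → Dist G v w a → Within (n ∸ ∣ S ∣) S v
  Dist-to-member⇒Within {S} {a = a} w∈S d with Dist⇒Geodesic d
  ... | f , refl , refl , geo =
    f t , ft∈S , t , geodesic-prefix geo t t≤a ,
    injective-outside⇒≤∸∣∣ S f t before-t∉S
      (λ s<t s′<t → geodesic-injective geo (≤-trans (<⇒≤ s<t) t≤a) (≤-trans (<⇒≤ s′<t) t≤a))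
    where
    first-hit = minimal-witness (λ t → f t ∈? S) a w∈S
    t = proj₁ first-hit
    ft∈S = proj₁ (proj₂ first-hit)
    t≤a : t ≤ a
    t≤a = proj₂ (proj₂ first-hit) a w∈S
    before-t∉S : ∀ s → s < t → f s ∉ S
    before-t∉S s s<t fs∈S = <⇒≱ s<t (proj₂ (proj₂ first-hit) s fs∈S)

  -- Without decidable adjacency distances cannot be computed; the resolving
  -- property is what supplies a geodesic from v into S.
  resolving⇒DistDominating : ∀ {S} → Connected G → Resolving G S → Nonempty S →
    DistDominating G (n ∸ ∣ S ∣) S
  resolving⇒DistDominating {S} conn res (w , w∈S) v v∉S with conn v w
  ... | _ , nil = ⊥-elim (v∉S w∈S)
  ... | _ , cons {w = x} e _ with x ∈? S
  ...   | yes x∈S = Dist-to-member⇒Within x∈S (Adj⇒Dist-1 e)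
  ...   | no x∉S with res v x v∉S x∉S (λ { refl → Adj-irrefl e })
  ...     | u , u∈S , _ , _ , d , _ = Dist-to-member⇒Within u∈S d

  Within-⊆ : ∀ {k S T v} → S ⊆ T → Within k S v → Within k T v
  Within-⊆ S⊆T (u , u∈S , close) = u , S⊆T u∈S , close

  Resolving⇒Nonempty : ∀ {S} → 2 ≤ n → Resolving G S → Nonempty S
  Resolving⇒Nonempty {S} (s≤s (s≤s _)) res with nonempty? S
  ... | yes ne = ne
  ... | no empty with res fzero (fsuc fzero) (λ z∈ → empty (_ , z∈)) (λ o∈ → empty (_ , o∈)) (λ ())
  ...   | w , w∈S , _ = ⊥-elim (empty (w , w∈S))

  Resolving-⊆ : ∀ {S T} → S ⊆ T → Resolving G S → Resolving G T
  Resolving-⊆ S⊆T res u v u∉T v∉T u≢v with res u v (u∉T ∘ S⊆T) (v∉T ∘ S⊆T) u≢v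
  ... | w , w∈S , separated = w , S⊆T w∈S , separated

  enumeration⇒IsPath : (q : ℕ → Fin n) (m : ℕ) → (∀ v → ∃ λ t → t < m × v ≡ q t) →
    InjectiveBelow q m → (∀ {a b} → a < m → b < m → Adj (q a) (q b) → Consecutive a b) →
    (∀ {a} → suc a < m → Adj (q a) (q (suc a))) → IsPath G
  enumeration⇒IsPath q m enumerates injective Adj⇒Consecutive Adj-suc =
    mk↔ₛ′ to from to∘from from∘to , λ a b → Adj⇒Consecutive (<m a) (<m b) , Consecutive⇒Adj a b
    where
    index : Fin n → Fin m
    index v = fromℕ< (proj₁ (proj₂ (enumerates v)))
    q-index : ∀ v → q (toℕ (index v)) ≡ v
    q-index v = trans (cong q (toℕ-fromℕ< _)) (sym (proj₂ (proj₂ (enumerates v))))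
    n≤m : n ≤ m
    n≤m = injective⇒≤ {f = index} λ {u} {v} i≡i →
      trans (sym (q-index u)) (trans (cong (q ∘ toℕ) i≡i) (q-index v))
    m≤n : m ≤ n
    m≤n = injective⇒≤ {f = q ∘ toℕ} λ {a} {b} qa≡qb → toℕ-injective (injective (toℕ<n a) (toℕ<n b) qa≡qb)
    <m : (a : Fin n) → toℕ a < m
    <m a = ≤-trans (toℕ<n a) n≤m
    to : Fin n → Fin n
    to a = q (toℕ a)
    from : Fin n → Fin n
    from v = fromℕ< (≤-trans (toℕ<n (index v)) m≤n)
    to∘from : ∀ v → to (from v) ≡ v
    to∘from v = trans (cong q (toℕ-fromℕ< _)) (q-index v)
    from∘to : ∀ a → from (to a) ≡ a
    from∘to a = toℕ-injective (trans (toℕ-fromℕ< _)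
      (injective (toℕ<n (index (to a))) (<m a) (q-index (to a))))
    Consecutive⇒Adj : ∀ a b → Consecutive (toℕ a) (toℕ b) → Adj (to a) (to b)
    Consecutive⇒Adj a b (inj₁ b≡1+a) =
      subst (λ j → Adj (to a) (q j)) (sym b≡1+a) (Adj-suc (subst (_< m) b≡1+a (<m b)))
    Consecutive⇒Adj a b (inj₂ a≡1+b) =
      Adj-sym (subst (λ j → Adj (to b) (q j)) (sym a≡1+b) (Adj-suc (subst (_< m) a≡1+b (<m a))))

module DecidableAdjacency {n : ℕ} (G : Graph n) (Adj? : ∀ u v → Dec (Graph.Adj G u v))
                          (conn : Connected G) where
  open Graph G
  open WalkProperties G

  walk? : ∀ m u v → Dec (Walk G u v m)
  walk? zero u v with u ≟ᶠ v
  ... | yes refl = yes nil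
  ... | no u≢v = no λ { nil → u≢v refl }
  walk? (suc m) u v with any? (λ w → Adj? u w ×-dec walk? m w v)
  ... | yes (w , e , p) = yes (cons e p)
  ... | no none = no λ { (cons e p) → none (_ , e , p) }

  dist : ∀ u v → ∃ (Dist G u v)
  dist u v with minimal-witness (λ m → walk? m u v) _ (proj₂ (conn u v))
  ... | m , p , least = m , p , least

  Reaches : Subset n → Fin n → ℕ → Set
  Reaches S x m = ∃ λ w → w ∈ S × Walk G x w m

  shortest-reach : ∀ {S x m} → Reaches S x m →
    Σ ℕ λ l → Reaches S x l × (∀ m → Reaches S x m → l ≤ m)
  shortest-reach {S} {x} {m} =
    minimal-witness (λ m → any? (λ w → (w ∈? S) ×-dec walk? m x w)) m

  Walk⇒Within : ∀ {S x w m k} → w ∈ S → Walk G x w m → m ≤ k → Within k S x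
  Walk⇒Within w∈S p m≤k with shortest-reach (_ , w∈S , p)
  ... | l , (u , u∈S , q) , least =
    u , u∈S , l , (q , λ m′ q′ → least m′ (u , u∈S , q′)) , ≤-trans (least _ (_ , w∈S , p)) m≤k

  module Nearest (S : Subset n) (nonempty : Nonempty S) where

    nearest : ∀ x → Σ ℕ λ l → Reaches S x l × (∀ m → Reaches S x m → l ≤ m)
    nearest x = shortest-reach (proj₁ nonempty , proj₂ nonempty , proj₂ (conn x (proj₁ nonempty)))

    level : Fin n → ℕ
    level x = proj₁ (nearest x)

    level-≤ : ∀ {x w m} → w ∈ S → Walk G x w m → level x ≤ m
    level-≤ {x} w∈S p = proj₂ (proj₂ (nearest x)) _ (_ , w∈S , p)

    level-Adj : ∀ {a b} → Adj a b → level a ≤ suc (level b)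
    level-Adj {b = b} e with proj₁ (proj₂ (nearest b))
    ... | w , w∈S , p = level-≤ w∈S (cons e p)

    level≤⇒Within : ∀ {x k} → level x ≤ k → Within k S x
    level≤⇒Within {x} l≤k with proj₁ (proj₂ (nearest x))
    ... | w , w∈S , p = Walk⇒Within w∈S p l≤k

    record Descent (x : Fin n) (l : ℕ) : Set where
      field
        path : ℕ → Fin n
        path-0 : path 0 ≡ x
        geodesic : Geodesic path l
        level-path : ∀ t → t ≤ l → level (path t) + t ≡ l

    shortest-reach⇒Descent : ∀ {x l} → Reaches S x l → (∀ m → Reaches S x m → l ≤ m) → Descent x l
    shortest-reach⇒Descent {l = l} (w , w∈S , p) least with walk⇒WalkSeq p
    ... | f , refl , refl , steps = record
      { path = f ; path-0 = refl ; geodesic = steps , p , λ m q → least m (_ , w∈S , q)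
      ; level-path = level-path }
      where
      level-path : ∀ t → t ≤ l → level (f t) + t ≡ l
      level-path t t≤l = ≤-antisym upper lower
        where
        t+[l∸t]≡l = m+[n∸m]≡n t≤l
        upper : level (f t) + t ≤ l
        upper = begin
          level (f t) + t ≤⟨ +-monoˡ-≤ t (level-≤ (subst (λ j → f j ∈ S) (sym t+[l∸t]≡l) w∈S)
                                            (segment steps t (l ∸ t) (≤-reflexive t+[l∸t]≡l))) ⟩
          (l ∸ t) + t     ≡⟨ m∸n+n≡m t≤l ⟩
          l ∎
          where open ≤-Reasoning
        lower : l ≤ level (f t) + t
        lower with proj₁ (proj₂ (nearest (f t)))
        ... | w′ , w′∈S , q =
          subst (l ≤_) (+-comm t _) (least _ (w′ , w′∈S , segment steps 0 t t≤l ++ʷ q))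

    descent : ∀ x → Descent x (level x)
    descent x = shortest-reach⇒Descent (proj₁ (proj₂ (nearest x))) (proj₂ (proj₂ (nearest x)))

    level-attained : ∀ {x j} → j ≤ level x → ∃ λ y → level y ≡ j
    level-attained {x} {j} j≤l = path t , +-cancelʳ-≡ t _ j
        (trans (level-path t (m∸n≤m (level x) j)) (sym (m+[n∸m]≡n j≤l)))
      where
      open Descent (descent x)
      t = level x ∸ j

    level-step : ∀ {x} → 0 < level x → ∃ λ y → Adj x y × suc (level y) ≡ level x
    level-step {x} 0<l =
      path 1 , subst (λ a → Adj a (path 1)) path-0 (proj₁ geodesic 0 0<l) ,
      trans (+-comm 1 _) (level-path 1 0<l)
      where open Descent (descent x)

  module Shrink (k : ℕ) (2≤k : 2 ≤ k) (W : Subset n) (nonempty : Nonempty W) (resW : Resolving G W) where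
    open Nearest W nonempty

    module Spine (y : Fin n) (level-y : level y ≡ suc k) where
      open Descent (subst (Descent y) level-y (descent y))
        renaming (path to q; geodesic to q-geodesic; level-path to level-q)

      q-steps : WalkSeq q (suc k)
      q-steps = proj₁ q-geodesic

      q-injective : ∀ {a b} → a ≤ suc k → b ≤ suc k → q a ≡ q b → a ≡ b
      q-injective = geodesic-injective q-geodesic

      level-q-≥ : ∀ {j s} → s ≤ suc k → j ≤ level (q s) → j + s ≤ suc k
      level-q-≥ {j} {s} s≤ j≤ = ≤-trans (+-monoˡ-≤ s j≤) (≤-reflexive (level-q s s≤))

      q∉W : ∀ t → t ≤ k → q t ∉ W
      q∉W t t≤k qt∈W = <⇒≱ (s≤s t≤k) (begin
        suc k           ≡⟨ sym (level-q t (m≤n⇒m≤1+n t≤k)) ⟩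
        level (q t) + t ≤⟨ +-monoˡ-≤ t (level-≤ qt∈W nil) ⟩
        t               ∎)
        where open ≤-Reasoning

      q-Adj-bound : ∀ {s t} → s ≤ suc k → t ≤ suc k → Adj (q s) (q t) → t ≤ suc s
      q-Adj-bound {s} {t} s≤ t≤ e = +-cancelˡ-≤ (level (q t)) t (suc s) (begin
        level (q t) + t       ≡⟨ trans (level-q t t≤) (sym (level-q s s≤)) ⟩
        level (q s) + s       ≤⟨ +-monoˡ-≤ s (level-Adj e) ⟩
        suc (level (q t)) + s ≡⟨ sym (+-suc _ s) ⟩
        level (q t) + suc s   ∎)
        where open ≤-Reasoning

      OnSpine : Fin n → Set
      OnSpine x = ∃ λ t → t < suc (suc k) × x ≡ q t

      onSpine? : ∀ x → Dec (OnSpine x)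
      onSpine? x = anyUpTo? (λ t → x ≟ᶠ q t) (suc (suc k))

      module OffSpine (z : Fin n) (z∉W : z ∉ W) (z-off : ¬ OnSpine z) where

        Removed : Fin n → Set
        Removed x = x ≡ z ⊎ ∃ λ t → t < k × x ≡ q (suc t)

        removed? : ∀ x → Dec (Removed x)
        removed? x = (x ≟ᶠ z) ⊎-dec anyUpTo? (λ t → x ≟ᶠ q (suc t)) k

        T : Subset n
        T = fromDec (¬? ∘ removed?)

        ∉T⇒Removed : ∀ {x} → x ∉ T → Removed x
        ∉T⇒Removed {x} x∉T = decidable-stable (removed? x) (∉-fromDec (¬? ∘ removed?) x∉T)

        W⊆T : W ⊆ T
        W⊆T x∈W = ∈-fromDec⁺ (¬? ∘ removed?) λ
          { (inj₁ refl) → z∉W x∈W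
          ; (inj₂ (t , t<k , refl)) → q∉W (suc t) t<k x∈W }

        q₀∈T : q 0 ∈ T
        q₀∈T = ∈-fromDec⁺ (¬? ∘ removed?) λ
          { (inj₁ q₀≡z) → z-off (0 , s≤s z≤n , sym q₀≡z)
          ; (inj₂ (t , t<k , q₀≡q₁₊ₜ)) → 0≢1+n (q-injective z≤n (s≤s (<⇒≤ t<k)) q₀≡q₁₊ₜ) }

        removed : ℕ → Fin n
        removed zero = z
        removed (suc t) = q (suc t)

        slack : k < n ∸ ∣ T ∣
        slack = injective-outside⇒≤∸∣∣ T removed (suc k) outside injective
          where
          outside : ∀ s → s < suc k → removed s ∉ T
          outside zero _ z∈T = ∈-fromDec⁻ (¬? ∘ removed?) z∈T (inj₁ refl)
          outside (suc s) (s≤s s<k) q∈T = ∈-fromDec⁻ (¬? ∘ removed?) q∈T (inj₂ (s , s<k , refl))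
          injective : InjectiveBelow removed (suc k)
          injective {zero} {zero} _ _ _ = refl
          injective {zero} {suc s′} _ s′<k z≡q = ⊥-elim (z-off (suc s′ , m≤n⇒m≤1+n s′<k , z≡q))
          injective {suc s} {zero} s<k _ q≡z = ⊥-elim (z-off (suc s , m≤n⇒m≤1+n s<k , sym q≡z))
          injective {suc s} {suc s′} s<k s′<k q≡q = q-injective (<⇒≤ s<k) (<⇒≤ s′<k) q≡q

        -- A geodesic from z to W leaves z into T or into q₁: the levels of q₂, …, q_k are too small.
        z-within : Within k T z
        z-within with level z ≤? k
        ... | yes l≤k = Within-⊆ W⊆T (level≤⇒Within l≤k)
        ... | no l≰k with level-step {z} (≤-trans (s≤s z≤n) (≰⇒> l≰k))
        ...   | z₁ , e , level-z₁ with removed? z₁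
        ...     | no z₁∈T = Walk⇒Within (∈-fromDec⁺ (¬? ∘ removed?) z₁∈T) (cons e nil) (≤-trans (s≤s z≤n) 2≤k)
        ...     | yes (inj₁ refl) = ⊥-elim (Adj-irrefl e)
        ...     | yes (inj₂ (t , t<k , refl)) =
          through-q₁ t t<k (s≤s⁻¹ (subst (suc k ≤_) (sym level-z₁) (≰⇒> l≰k))) e
          where
          through-q₁ : ∀ t → t < k → k ≤ level (q (suc t)) → Adj z (q (suc t)) → Within k T z
          through-q₁ zero _ _ e = Walk⇒Within q₀∈T (cons e (cons (Adj-sym (q-steps 0 (s≤s z≤n))) nil)) 2≤k
          through-q₁ (suc t) t<k k≤level _ = ⊥-elim (m+1+n≰m k (s≤s⁻¹
            (subst (_≤ suc k) (+-suc k (suc t)) (level-q-≥ (s≤s (<⇒≤ t<k)) k≤level))))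

        dominating : DistDominating G k T
        dominating v v∉T with ∉T⇒Removed v∉T
        ... | inj₁ refl = z-within
        ... | inj₂ (t , t<k , refl) =
          Walk⇒Within q₀∈T (reverseʷ (segment q-steps 0 (suc t) (s≤s (<⇒≤ t<k)))) t<k

      module SpineCovers (none-off : ¬ ∃ λ z → z ∉ W × ¬ OnSpine z) where

        covers : ∀ z → z ∉ W → OnSpine z
        covers z z∉W = decidable-stable (onSpine? z) (λ z-off → none-off (z , z∉W , z-off))

        neighbour-of-q≤1 : ∀ {s a} → s ≤ 1 → Adj (q s) a → ∃ λ t → t ≤ suc s × t ≢ s × a ≡ q t
        neighbour-of-q≤1 {s} {a} s≤1 e with a ∈? W
        ... | yes a∈W = ⊥-elim (<⇒≱ 2≤k (s≤s⁻¹ (begin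
          suc k           ≡⟨ sym (level-q s (≤-trans s≤1 (s≤s z≤n))) ⟩
          level (q s) + s ≤⟨ +-mono-≤ (level-≤ a∈W (cons e nil)) s≤1 ⟩
          2               ∎)))
          where open ≤-Reasoning
        ... | no a∉W with covers a a∉W
        ...   | t , t<2+k , refl =
          t , q-Adj-bound (≤-trans s≤1 (s≤s z≤n)) (s≤s⁻¹ t<2+k) e , (λ { refl → Adj-irrefl e }) , refl

        q₀-neighbour : ∀ {a} → Adj (q 0) a → a ≡ q 1
        q₀-neighbour e with neighbour-of-q≤1 z≤n e
        ... | 0 , _ , t≢0 , _ = ⊥-elim (t≢0 refl)
        ... | 1 , _ , _ , a≡q₁ = a≡q₁
        ... | suc (suc _) , s≤s () , _

        q₁-neighbour : ∀ {b} → Adj (q 1) b → b ≡ q 0 ⊎ b ≡ q 2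
        q₁-neighbour e with neighbour-of-q≤1 (s≤s z≤n) e
        ... | 0 , _ , _ , b≡q₀ = inj₁ b≡q₀
        ... | 1 , _ , t≢1 , _ = ⊥-elim (t≢1 refl)
        ... | 2 , _ , _ , b≡q₂ = inj₂ b≡q₂
        ... | suc (suc (suc _)) , s≤s (s≤s ()) , _

        walk-from-q₀ : ∀ {x m} → x ≢ q 0 → x ≢ q 1 → Walk G (q 0) x m →
          ∃ λ m′ → Walk G (q 2) x m′ × 2 + m′ ≤ m
        walk-from-q₀ x≢q₀ _ nil = ⊥-elim (x≢q₀ refl)
        walk-from-q₀ _ x≢q₁ (cons e nil) = ⊥-elim (x≢q₁ (q₀-neighbour e))
        walk-from-q₀ x≢q₀ x≢q₁ (cons e (cons e′ p)) with q₀-neighbour e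
        ... | refl with q₁-neighbour e′
        ...   | inj₂ refl = _ , p , ≤-refl
        ...   | inj₁ refl with walk-from-q₀ x≢q₀ x≢q₁ p
        ...     | m′ , p′ , 2+m′≤m = m′ , p′ , m≤n⇒m≤1+n (m≤n⇒m≤1+n 2+m′≤m)

        Kept : Fin n → Set
        Kept x = (x ∈ W × x ≢ q (suc k)) ⊎ x ≡ q 1

        kept? : ∀ x → Dec (Kept x)
        kept? x = ((x ∈? W) ×-dec ¬? (x ≟ᶠ q (suc k))) ⊎-dec (x ≟ᶠ q 1)

        T : Subset n
        T = fromDec kept?

        q₁∈T : q 1 ∈ T
        q₁∈T = ∈-fromDec⁺ kept? (inj₂ refl)

        ∉T⇒on-spine : ∀ {v} → v ∉ T → ∃ λ t → t ≤ suc k × t ≢ 1 × v ≡ q t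
        ∉T⇒on-spine {v} v∉T with v ∈? W
        ... | no v∉W with covers v v∉W
        ...   | t , t<2+k , refl = t , s≤s⁻¹ t<2+k , (λ { refl → v∉T q₁∈T }) , refl
        ∉T⇒on-spine {v} v∉T | yes v∈W with v ≟ᶠ q (suc k)
        ...   | yes v≡end = suc k , ≤-refl , (λ k+1≡1 → <⇒≱ 2≤k (subst (_≤ 1) (sym (suc-injective k+1≡1)) z≤n)) , v≡end
        ...   | no v≢end = ⊥-elim (v∉T (∈-fromDec⁺ kept? (inj₁ (v∈W , v≢end))))

        dist-to-1 : ℕ → ℕ
        dist-to-1 zero = 1
        dist-to-1 (suc t) = t

        q-to-q₁ : ∀ t → t ≤ suc k → Dist G (q t) (q 1) (dist-to-1 t)
        q-to-q₁ zero _ = Adj⇒Dist-1 (q-steps 0 (s≤s z≤n))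
        q-to-q₁ (suc t) t<1+k = Dist-sym (geodesic-segment q-geodesic 1 t t<1+k)

        dominating : DistDominating G k T
        dominating v v∉T with ∉T⇒on-spine v∉T
        ... | zero , _ , _ , refl = q 1 , q₁∈T , 1 , q-to-q₁ 0 z≤n , ≤-trans (s≤s z≤n) 2≤k
        ... | suc t , t<1+k , _ , refl = q 1 , q₁∈T , t , q-to-q₁ (suc t) t<1+k , s≤s⁻¹ t<1+k

        removed : ℕ → Fin n
        removed zero = q 0
        removed (suc s) = q (suc (suc s))

        slack : k < n ∸ ∣ T ∣
        slack = injective-outside⇒≤∸∣∣ T removed (suc k) outside injective
          where
          outside : ∀ s → s < suc k → removed s ∉ T
          outside zero _ q₀∈T with ∈-fromDec⁻ kept? q₀∈T
          ... | inj₁ (q₀∈W , _) = q∉W 0 z≤n q₀∈W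
          ... | inj₂ q₀≡q₁ = 0≢1+n (q-injective z≤n (s≤s z≤n) q₀≡q₁)
          outside (suc s) s<k q∈T with ∈-fromDec⁻ kept? q∈T
          ... | inj₂ q≡q₁ = 1+n≢0 (suc-injective (q-injective s<k (s≤s z≤n) q≡q₁))
          ... | inj₁ (q∈W , q≢end) with suc (suc s) ≟ⁿ suc k
          ...   | yes ≡end = q≢end (cong q ≡end)
          ...   | no ≢end = q∉W (suc (suc s)) (s≤s⁻¹ (≤∧≢⇒< s<k ≢end)) q∈W
          injective : InjectiveBelow removed (suc k)
          injective {zero} {zero} _ _ _ = refl
          injective {zero} {suc s′} _ s′<k q≡q = ⊥-elim (0≢1+n (q-injective z≤n s′<k q≡q))
          injective {suc s} {zero} s<k _ q≡q = ⊥-elim (1+n≢0 (q-injective s<k z≤n q≡q))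
          injective {suc s} {suc s′} s<k s′<k q≡q = suc-injective (q-injective s<k s′<k q≡q)

        module Landmark (x : Fin n) (x∈W : x ∈ W) (x≢end : x ≢ q (suc k)) where

          x∈T : x ∈ T
          x∈T = ∈-fromDec⁺ kept? (inj₁ (x∈W , x≢end))

          x-separates : ∀ {d₀ d₂} → Dist G (q 0) x d₀ → Dist G (q 2) x d₂ → d₀ ≢ d₂
          x-separates (p , _) (_ , least) refl with walk-from-q₀ x≢q₀ x≢q₁ p
            where
            x≢q₀ : x ≢ q 0
            x≢q₀ x≡q₀ = q∉W 0 z≤n (subst (_∈ W) x≡q₀ x∈W)
            x≢q₁ : x ≢ q 1
            x≢q₁ x≡q₁ = q∉W 1 (≤-trans (s≤s z≤n) 2≤k) (subst (_∈ W) x≡q₁ x∈W)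
          ... | m′ , p′ , 2+m′≤d = <⇒≱ (≤-trans (n≤1+n _) 2+m′≤d) (least m′ p′)

          equal-dist-to-1 : ∀ {a b} → a ≢ 1 → b ≢ 1 → a ≢ b → dist-to-1 a ≡ dist-to-1 b →
            (a ≡ 0 × b ≡ 2) ⊎ (a ≡ 2 × b ≡ 0)
          equal-dist-to-1 {0} {0} _ _ a≢b _ = ⊥-elim (a≢b refl)
          equal-dist-to-1 {0} {1} _ b≢1 _ _ = ⊥-elim (b≢1 refl)
          equal-dist-to-1 {0} {2} _ _ _ _ = inj₁ (refl , refl)
          equal-dist-to-1 {1} a≢1 _ _ _ = ⊥-elim (a≢1 refl)
          equal-dist-to-1 {2} {0} _ _ _ _ = inj₂ (refl , refl)
          equal-dist-to-1 {suc a} {suc b} _ _ a≢b a≡b = ⊥-elim (a≢b (cong suc a≡b))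

          resolving : Resolving G T
          resolving u v u∉T v∉T u≢v with ∉T⇒on-spine u∉T | ∉T⇒on-spine v∉T
          ... | a , a≤ , a≢1 , refl | b , b≤ , b≢1 , refl with dist-to-1 a ≟ⁿ dist-to-1 b
          ...   | no a≢b = q 1 , q₁∈T , _ , _ , q-to-q₁ a a≤ , q-to-q₁ b b≤ , a≢b
          ...   | yes a≡b with equal-dist-to-1 a≢1 b≢1 (u≢v ∘ cong q) a≡b
          ...     | inj₁ (refl , refl) =
            x , x∈T , _ , _ , proj₂ (dist (q 0) x) , proj₂ (dist (q 2) x) ,
            x-separates (proj₂ (dist (q 0) x)) (proj₂ (dist (q 2) x))
          ...     | inj₂ (refl , refl) =
            x , x∈T , _ , _ , proj₂ (dist (q 2) x) , proj₂ (dist (q 0) x) ,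
            x-separates (proj₂ (dist (q 0) x)) (proj₂ (dist (q 2) x)) ∘ sym

        spine-IsPath : (∀ x → x ∈ W → x ≡ q (suc k)) → IsPath G
        spine-IsPath only-end = enumeration⇒IsPath q (suc (suc k)) enumerates
          (λ a< b< → q-injective (s≤s⁻¹ a<) (s≤s⁻¹ b<))
          (λ a< b< e → consecutive (λ { refl → Adj-irrefl e })
            (q-Adj-bound (s≤s⁻¹ a<) (s≤s⁻¹ b<) e) (q-Adj-bound (s≤s⁻¹ b<) (s≤s⁻¹ a<) (Adj-sym e)))
          (λ 1+a<2+k → q-steps _ (s≤s⁻¹ 1+a<2+k))
          where
          enumerates : ∀ v → OnSpine v
          enumerates v with v ∈? W
          ... | yes v∈W = suc k , ≤-refl , only-end v v∈W
          ... | no v∉W = covers v v∉W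

      spine⇒resolvingDominating : ¬ IsPath G →
        ∃ λ T → (Resolving G T × DistDominating G k T) × k < n ∸ ∣ T ∣
      spine⇒resolvingDominating ¬path with any? (λ z → ¬? (z ∈? W) ×-dec ¬? (onSpine? z))
      ... | yes (z , z∉W , z-off) = T , (Resolving-⊆ W⊆T resW , dominating) , slack
        where open OffSpine z z∉W z-off
      ... | no none-off with any? (λ x → (x ∈? W) ×-dec ¬? (x ≟ᶠ q (suc k)))
      ...   | yes (x , x∈W , x≢end) = T , (Landmark.resolving x x∈W x≢end , dominating) , slack
        where open SpineCovers none-off
      ...   | no none-other = ⊥-elim (¬path (spine-IsPath only-end))
        where
        open SpineCovers none-off
        only-end : ∀ x → x ∈ W → x ≡ q (suc k)
        only-end x x∈W = decidable-stable (x ≟ᶠ q (suc k)) (λ x≢end → none-other (x , x∈W , x≢end))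

    resolving⇒resolvingDominating : k < n ∸ ∣ W ∣ → ¬ IsPath G →
      ∃ λ T → (Resolving G T × DistDominating G k T) × k < n ∸ ∣ T ∣
    resolving⇒resolvingDominating W-slack ¬path with any? (λ v → suc k ≤? level v)
    ... | no none-far = W , (resW , λ v _ → level≤⇒Within (≮⇒≥ (λ k<l → none-far (v , k<l)))) , W-slack
    ... | yes (v , k<level-v) with level-attained k<level-v
    ...   | y , level-y = Spine.spine⇒resolvingDominating y level-y ¬path

metricDim⇒resolvingDomNum : ∀ {n k m} (G : Graph n) → 2 ≤ n → n ∸ m ≤ k → Connected G →
  MetricDim G m → ResolvingDomNum G k m
metricDim⇒resolvingDomNum {k = k} G 2≤n n∸m≤k conn ((S , res , refl) , minimum) =
  (S , (res , dominating) , refl) , λ T resDomT → minimum T (proj₁ resDomT)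
  where
  open WalkProperties G
  dominating : DistDominating G k S
  dominating = DistDominating-mono n∸m≤k (resolving⇒DistDominating conn res (Resolving⇒Nonempty 2≤n res))

¬¬-Dec-Adj : ∀ {n} (G : Graph n) → ¬ ¬ (∀ u v → Dec (Graph.Adj G u v))
¬¬-Dec-Adj G = ¬¬-∀-Fin λ u → ¬¬-∀-Fin λ v → ¬¬-excluded-middle

resolvingDomNum⇒metricDim : ∀ {n k m} (G : Graph n) → 2 ≤ n → 2 ≤ k → n ∸ m ≤ k →
  Connected G → ¬ IsPath G → ResolvingDomNum G k m → MetricDim G m
resolvingDomNum⇒metricDim {n} {k} G 2≤n 2≤k n∸m≤k conn ¬path ((S , (resS , _) , refl) , minimum) =
  (S , resS , refl) , lower-bound
  where
  open WalkProperties G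
  lower-bound : ∀ W → Resolving G W → ∣ S ∣ ≤ ∣ W ∣
  lower-bound W resW with k <? n ∸ ∣ W ∣
  ... | no k≮slack = minimum W (resW , DistDominating-mono (≮⇒≥ k≮slack)
                                         (resolving⇒DistDominating conn resW (Resolving⇒Nonempty 2≤n resW)))
  ... | yes k<slack = ⊥-elim (¬¬-Dec-Adj G λ Adj? →
    let open DecidableAdjacency G Adj? conn
        open Shrink k 2≤k W (Resolving⇒Nonempty 2≤n resW) resW
        T , resDomT , k<T-slack = resolving⇒resolvingDominating k<slack ¬path
    in <⇒≱ k<T-slack (≤-trans (∸-monoʳ-≤ n (minimum T resDomT)) n∸m≤k))

lemma3p1 : (k i n : ℕ) → 2 ≤ k → 1 ≤ i → i ≤ k → i + 2 ≤ n →
    (G : Graph n) → Connected G → ¬ IsPath G →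
    (ResolvingDomNum G k (n ∸ i) → MetricDim G (n ∸ i))
      × (MetricDim G (n ∸ i) → ResolvingDomNum G k (n ∸ i))
lemma3p1 k i n 2≤k _ i≤k i+2≤n G conn ¬path =
  resolvingDomNum⇒metricDim G 2≤n 2≤k n∸[n∸i]≤k conn ¬path ,
  metricDim⇒resolvingDomNum G 2≤n n∸[n∸i]≤k conn
  where
  2≤n : 2 ≤ n
  2≤n = m+n≤o⇒n≤o i i+2≤n
  n∸[n∸i]≤k : n ∸ (n ∸ i) ≤ k
  n∸[n∸i]≤k = subst (_≤ k) (sym (m∸[m∸n]≡n (m+n≤o⇒m≤o i i+2≤n))) i≤k
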